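{- Let $P,Q$ be finite posets with $|P|=p$, $|Q|=q$, let $D_\lambda=C_{\lambda_1}+\cdots+C_{\lambda_s}\in\mathfrak{D}_n$, and $R=P\oplus D_\lambda\oplus Q$. Let $1\le j<k\le p+n+q$ with $k=p+n+r$ for some integer $r\ge0$ and $p<k-j<p+n$. Let $m=r\bmod n$ and $\ell=k-j-p$. Let $w$ be the permutation of $\{1,\ldots,n\}$ with $w\big((m-\ell+t)\bmod n\big)=(m-t)\bmod n$ for $t=0,1,\ldots,\ell$, fixing all other elements. Then for every linear extension $f$ of $R$, if $(L_1,\ldots,L_s)$ is the ordered set partition of $I(f)$, the ordered set partition of $I(q_{jk}(f))$ is $(w(L_1),\ldots,w(L_s))$.
   Context: For a finite poset $X$ with $|X|=N$, a linear extension is a bijection $f:X\to\{1,\ldots,N\}$ with $f(a)<f(b)$ whenever $a<_X b$. For $1\le i\le N-1$ the Bender–Knuth involution $t_i$ swaps labels $i$ and $i+1$ if $f^{ -1}(i)$, $f^{ -1}(i+1)$ are incomparable, and does nothing otherwise. Products denote composition, rightmost first. $q_0=\mathrm{id}$, $q_i=t_1(t_2t_1)\cdots(t_it_{i-1}\cdots t_1)$, $q_{jk}=q_{k-1}q_{k-j}q_{k-1}$. $X\oplus Y$: ordinal sum (all of $X$ below all of $Y$); $+$: disjoint union; $C_m$: $m$-element chain. For $n>1$, $\mathfrak{D}_n$ is the set of posets $C_{\lambda_1}+\cdots+C_{\lambda_s}$ with $\lambda\vdash n$, $s>1$. For a linear extension $f$ of $R$, $I(f)$ is the linear extension of $D_\lambda$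 with $I(f)(x)=f(x)-p$. The ordered set partition of a linear extension $g$ of $D_\lambda$ is $(g(C_{\lambda_1}),\ldots,g(C_{\lambda_s}))$. Convention: $a\bmod n$ denotes the representative in $\{1,\ldots,n\}$. -}

module Defs where

open import Level using (0ℓ)
open import Data.Nat as ℕ using (ℕ; zero; suc; _+_; _≤_; _<_; NonZero)
open import Data.Nat.Properties using (<-trans; n<1+n)
open import Data.Fin as Fin using (Fin; toℕ; fromℕ<)
open import Data.Vec using (Vec; lookup)
open import Data.Integer as ℤ using (ℤ; +_; _%ℕ_)
open import Data.Product using (Σ; Σ-syntax; _×_; _,_)
open import Data.Sum using (_⊎_; inj₁; inj₂)
open import Data.Unit using (⊤; tt)
open import Data.Empty using (⊥)
open import Function using (_∘_)
open import Relation.Nullary using (Dec; yes; no)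
open import Relation.Nullary.Decidable using (_⊎-dec_; _×-dec_)
open import Relation.Binary using (Rel; Decidable; IsStrictPartialOrder)
open import Relation.Binary.PropositionalEquality using (_≡_)
open import Relation.Unary using (Pred)

record FinPoset (n : ℕ) : Set₁ where
  field
    _≺_    : Rel (Fin n) 0ℓ
    isSPO  : IsStrictPartialOrder _≡_ _≺_
    _≺?_   : Decidable _≺_

IsPartition : {s : ℕ} → Vec ℕ s → ℕ → Set
IsPartition {s} λs n =
  (∀ i → 0 < lookup λs i)
  × (∀ (i i′ : Fin s) → i Fin.≤ i′ → lookup λs i′ ≤ lookup λs i)
  × (Data.Vec.sum λs ≡ n)
  where import Data.Vec

-- D_λ = C_{λ_1} + ... + C_{λ_s}: element (i , a) is the a-th element
-- (0-based) of the i-th chain.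

DCar : {s : ℕ} → Vec ℕ s → Set
DCar {s} λs = Σ (Fin s) (λ i → Fin (lookup λs i))

_≺D_ : {s : ℕ} {λs : Vec ℕ s} → Rel (DCar λs) 0ℓ
(i , a) ≺D (i′ , b) = (i ≡ i′) × (toℕ a < toℕ b)

_≺D?_ : {s : ℕ} {λs : Vec ℕ s} → Decidable (_≺D_ {s} {λs})
(i , a) ≺D? (i′ , b) = (i Fin.≟ i′) ×-dec (toℕ a ℕ.<? toℕ b)

RCar : (p : ℕ) {s : ℕ} → Vec ℕ s → (q : ℕ) → Set
RCar p λs q = Fin p ⊎ (DCar λs ⊎ Fin q)

module Ordinal {p q s : ℕ} (P : FinPoset p) (λs : Vec ℕ s) (Q : FinPoset q) where
  open FinPoset P renaming (_≺_ to _≺P_; _≺?_ to _≺P?_)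
  open FinPoset Q renaming (_≺_ to _≺Q_; _≺?_ to _≺Q?_)

  _≺R_ : Rel (RCar p λs q) 0ℓ
  inj₁ a ≺R inj₁ b = a ≺P b
  inj₁ a ≺R inj₂ y = ⊤
  inj₂ x ≺R inj₁ b = ⊥
  inj₂ (inj₁ x) ≺R inj₂ (inj₁ y) = _≺D_ {s} {λs} x y
  inj₂ (inj₁ x) ≺R inj₂ (inj₂ b) = ⊤
  inj₂ (inj₂ a) ≺R inj₂ (inj₁ y) = ⊥
  inj₂ (inj₂ a) ≺R inj₂ (inj₂ b) = a ≺Q b

  _≺R?_ : Decidable _≺R_
  inj₁ a ≺R? inj₁ b = a ≺P? b
  inj₁ a ≺R? inj₂ y = yes tt
  inj₂ x ≺R? inj₁ b = no (λ ())
  inj₂ (inj₁ x) ≺R? inj₂ (inj₁ y) = _≺D?_ {s} {λs} x y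
  inj₂ (inj₁ x) ≺R? inj₂ (inj₂ b) = yes tt
  inj₂ (inj₂ a) ≺R? inj₂ (inj₁ y) = no (λ ())
  inj₂ (inj₂ a) ≺R? inj₂ (inj₂ b) = a ≺Q? b

-- Labellings: a function X → Fin N together with a designated inverse.
-- Label i ∈ {1..N} of the paper is the element i-1 of Fin N.

record Labelling (X : Set) (N : ℕ) : Set where
  constructor mkLab
  field
    lab : X → Fin N
    pos : Fin N → X
open Labelling public

record IsLinExt {X : Set} {N : ℕ} (_≺_ : Rel X 0ℓ) (f : Labelling X N) : Set where
  field
    lab∘pos : ∀ i → lab f (pos f i) ≡ i
    pos∘lab : ∀ x → pos f (lab f x) ≡ x
    mono    : ∀ {x y} → x ≺ y → lab f x Fin.< lab f y

swapFin : {N : ℕ} → Fin N → Fin N → Fin N → Fin N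
swapFin a b c with c Fin.≟ a
... | yes _ = b
... | no _ with c Fin.≟ b
...   | yes _ = a
...   | no _ = c

module BenderKnuth {X : Set} (_≺_ : Rel X 0ℓ) (_≺?_ : Decidable _≺_) (N : ℕ) where

  Comparable : X → X → Set
  Comparable x y = (x ≺ y) ⊎ (y ≺ x)

  -- t i (paper's t_i, 1 ≤ i ≤ N-1): swaps labels i and i+1 (i.e. the
  -- Fin-elements i-1 and i) when f⁻¹(i), f⁻¹(i+1) are incomparable.
  -- Outside the range 1 ≤ i ≤ N-1 it is the identity (never used there).
  t : ℕ → Labelling X N → Labelling X N
  t zero f = f
  t (suc i) f with suc i ℕ.<? N
  ... | no _ = f
  ... | yes h with (pos f a ≺? pos f b) ⊎-dec (pos f b ≺? pos f a)
    where a : Fin N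
          a = fromℕ< (<-trans (n<1+n i) h)
          b : Fin N
          b = fromℕ< h
  ...   | yes _ = f
  ...   | no _ = mkLab (swapFin a b ∘ lab f) (pos f ∘ swapFin a b)
    where a : Fin N
          a = fromℕ< (<-trans (n<1+n i) h)
          b : Fin N
          b = fromℕ< h

  down : ℕ → Labelling X N → Labelling X N
  down zero = λ f → f
  down (suc i) = t (suc i) ∘ down i

  -- q_0 = id, q_i = t_1 (t_2 t_1) ⋯ (t_i ⋯ t_1) = q_{i-1} ∘ (t_i ⋯ t_1)
  q : ℕ → Labelling X N → Labelling X N
  q zero = λ f → f
  q (suc i) = q i ∘ down (suc i)

  qjk : ℕ → ℕ → Labelling X N → Labelling X N
  qjk j k = q (k ℕ.∸ 1) ∘ q (k ℕ.∸ j) ∘ q (k ℕ.∸ 1)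

-- Ordered set partition of I(f), for f a labelling of R = P ⊕ D_λ ⊕ Q:
-- block i is I(f)(C_{λ_i}) = { f(x) - p : x ∈ C_{λ_i} } ⊆ {1..n},
-- with b : Fin n standing for the label toℕ b + 1.

OSP : {p q s n : ℕ} (λs : Vec ℕ s) → Labelling (RCar p λs q) (p + n + q)
      → Fin s → Pred (Fin n) 0ℓ
OSP {p} λs f i b =
  Σ[ a ∈ Fin (lookup λs i) ] toℕ (lab f (inj₂ (inj₁ (i , a)))) ≡ p + toℕ b

image : {n : ℕ} → (Fin n → Fin n) → Pred (Fin n) 0ℓ → Pred (Fin n) 0ℓ
image w L b = Σ[ c ∈ Fin _ ] (L c × w c ≡ b)

-- a mod n, with representative in {1, …, n}
_mod1_ : ℤ → (n : ℕ) → .{{NonZero n}} → ℕ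
(a mod1 n) = suc ((a ℤ.- ℤ.+ 1) %ℕ n)

{-# OPTIONS --safe #-}
module Submission where

-- In every linear extension of P ⊕ D_λ ⊕ Q the labels of D_λ are exactly p + 1, …, p + n (a
-- counting argument), and every Bender–Knuth move preserves this layering. A move t_i whose two
-- labels lie in D_λ either exchanges labels on different chains or meets two comparable elements,
-- which lie on one chain; either way it permutes the ordered set partition by the transposition
-- of positions i - p and i + 1 - p, and a move outside D_λ does not change the partition.
-- Composing, with K = n - 1 + r, the factor q_{k-1} of q_{jk} acts on positions as the reflection
-- ρ : x ↦ K - x (mod n) and q_{k-j} as the reversal τ of the first ℓ + 1 positions, so q_{jk}
-- acts by ρ τ ρ. This is the involution w of the statement.

open import Level using (0ℓ)
open import Defs
open import Data.Nat as ℕ using (ℕ; zero; suc; _+_; _*_; _∸_; _≤_; _<_; NonZero; z≤n; s≤s; _%_; _/_)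
open import Data.Nat.Properties
open import Data.Nat.DivMod using (m≡m%n+[m/n]*n; [m+kn]%n≡m%n; m%n<n; m<n⇒m%n≡m; n%n≡0)
open import Data.Fin as Fin using (Fin; toℕ; fromℕ<; opposite)
import Data.Fin.Properties as Finₚ
open import Data.Vec using (Vec; lookup)
open import Data.Integer as ℤ using (ℤ; +_; -[1+_]; _%ℕ_; _/ℕ_)
import Data.Integer.Properties as ℤₚ
open import Data.Integer.DivMod using (a≡a%ℕn+[a/ℕn]*n; n%ℕd<d)
open import Data.Integer.Tactic.RingSolver using (solve-∀)
open import Data.Product using (Σ-syntax; ∃; _×_; _,_; proj₁; proj₂)
open import Data.Sum as Sum using (_⊎_; inj₁; inj₂)
import Data.Sum.Properties as Sumₚ
open import Data.Unit using (tt)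
open import Data.Empty using (⊥-elim)
open import Function using (_∘_; id; flip)
open import Function.Bundles using (_⇔_; mk⇔; Equivalence)
import Function.Properties.Equivalence as ⇔
open import Function.Definitions using (Injective)
open import Relation.Nullary using (¬_; yes; no; _⊎-dec_)
open import Relation.Binary using (Rel)
open import Relation.Binary.PropositionalEquality
open import Relation.Unary using (_≐_)

transposeℕ : ℕ → ℕ → ℕ → ℕ
transposeℕ a b x with x ≟ a
... | yes _ = b
... | no _ with x ≟ b
...   | yes _ = a
...   | no _ = x

transposeℕ-left : ∀ a b → transposeℕ a b a ≡ b
transposeℕ-left a b with a ≟ a
... | yes _ = refl
... | no a≢a = ⊥-elim (a≢a refl)

transposeℕ-right : ∀ a b → transposeℕ a b b ≡ a
transposeℕ-right a b with b ≟ a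
... | yes b≡a = b≡a
... | no _ with b ≟ b
...   | yes _ = refl
...   | no b≢b = ⊥-elim (b≢b refl)

transposeℕ-other : ∀ {a b x} → x ≢ a → x ≢ b → transposeℕ a b x ≡ x
transposeℕ-other {a} {b} {x} x≢a x≢b with x ≟ a
... | yes x≡a = ⊥-elim (x≢a x≡a)
... | no _ with x ≟ b
...   | yes x≡b = ⊥-elim (x≢b x≡b)
...   | no _ = refl

transposeℕ-involutive : ∀ a b x → transposeℕ a b (transposeℕ a b x) ≡ x
transposeℕ-involutive a b x with x ≟ a
... | yes refl = transposeℕ-right x b
... | no x≢a with x ≟ b
...   | yes refl = transposeℕ-left a x
...   | no x≢b = transposeℕ-other x≢a x≢b

+-transposeℕ : ∀ p a b y → transposeℕ (p + a) (p + b) (p + y) ≡ p + transposeℕ a b y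
+-transposeℕ p a b y with y ≟ a
... | yes refl = transposeℕ-left (p + y) (p + b)
... | no y≢a with y ≟ b
...   | yes refl = transposeℕ-right (p + a) (p + y)
...   | no y≢b = transposeℕ-other (y≢a ∘ +-cancelˡ-≡ p _ _) (y≢b ∘ +-cancelˡ-≡ p _ _)

transposeℕ-resp-⇔ : (P : ℕ → Set) {a b : ℕ} → P a ⇔ P b → ∀ x → P x ⇔ P (transposeℕ a b x)
transposeℕ-resp-⇔ P {a} {b} Pa⇔Pb x with x ≟ a
... | yes refl = Pa⇔Pb
... | no _ with x ≟ b
...   | yes refl = ⇔.sym Pa⇔Pb
...   | no _ = ⇔.refl

transposeℕ-suc-< : ∀ {i v b} → suc i ≢ b → v < b → transposeℕ i (suc i) v < b
transposeℕ-suc-< {i} {v} {b} 1+i≢b v<b with v ≟ i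
... | yes refl = ≤∧≢⇒< v<b 1+i≢b
... | no _ with v ≟ suc i
...   | yes refl = ≤-trans (n≤1+n _) v<b
...   | no _ = v<b

transposeℕ-suc-≥ : ∀ {i v b} → suc i ≢ b → b ≤ v → b ≤ transposeℕ i (suc i) v
transposeℕ-suc-≥ {i} {v} {b} 1+i≢b b≤v with v ≟ i
... | yes refl = ≤-trans b≤v (n≤1+n _)
... | no _ with v ≟ suc i
...   | yes refl = ≤-pred (≤∧≢⇒< b≤v (1+i≢b ∘ sym))
...   | no _ = b≤v

toℕ-swapFin : ∀ {N} (a b c : Fin N) → toℕ (swapFin a b c) ≡ transposeℕ (toℕ a) (toℕ b) (toℕ c)
toℕ-swapFin a b c with c Fin.≟ a | toℕ c ≟ toℕ a
... | yes _   | yes _   = refl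
... | yes c≡a | no c≢a  = ⊥-elim (c≢a (cong toℕ c≡a))
... | no c≢a  | yes c≡a = ⊥-elim (c≢a (Finₚ.toℕ-injective c≡a))
... | no _    | no _ with c Fin.≟ b | toℕ c ≟ toℕ b
...   | yes _   | yes _   = refl
...   | yes c≡b | no c≢b  = ⊥-elim (c≢b (cong toℕ c≡b))
...   | no c≢b  | yes c≡b = ⊥-elim (c≢b (Finₚ.toℕ-injective c≡b))
...   | no _    | no _    = refl

swapFin-involutive : ∀ {N} (a b c : Fin N) → swapFin a b (swapFin a b c) ≡ c
swapFin-involutive a b c = Finₚ.toℕ-injective (begin
  toℕ (swapFin a b (swapFin a b c))         ≡⟨ toℕ-swapFin a b (swapFin a b c) ⟩
  τ (toℕ (swapFin a b c))                    ≡⟨ cong τ (toℕ-swapFin a b c) ⟩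
  τ (τ (toℕ c))                              ≡⟨ transposeℕ-involutive _ _ _ ⟩
  toℕ c                                      ∎)
  where
    open ≡-Reasoning
    τ : ℕ → ℕ
    τ = transposeℕ (toℕ a) (toℕ b)

module Counting {X : Set} {_≺_ : Rel X 0ℓ} {N : ℕ} {f : Labelling X N} (ext : IsLinExt _≺_ f) where
  open IsLinExt ext

  lab-injective : Injective _≡_ _≡_ (lab f)
  lab-injective {x} {y} e = trans (sym (pos∘lab x)) (trans (cong (pos f) e) (pos∘lab y))

  pos-injective : Injective _≡_ _≡_ (pos f)
  pos-injective {k} {l} e = trans (sym (lab∘pos k)) (trans (cong (lab f) e) (lab∘pos l))

  card-below : ∀ {m x} (ι : Fin m → X) → Injective _≡_ _≡_ ι → (∀ a → ι a ≺ x) →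
               m ≤ toℕ (lab f x)
  card-below {m} {x} ι ι-injective below = Finₚ.injective⇒≤ {f = g} g-injective
    where
      g : Fin m → Fin (toℕ (lab f x))
      g a = fromℕ< (mono (below a))
      g-injective : Injective _≡_ _≡_ g
      g-injective {a} {b} e =
        ι-injective (lab-injective (Finₚ.toℕ-injective (Finₚ.fromℕ<-injective _ _ _ _ e)))

  -- Every label l ≤ f(x) sits on an element of the image of ι, since f(x) < l otherwise.
  card-downset : ∀ {m x} (ι : Fin m → X) → (∀ y → (∃ λ a → ι a ≡ y) ⊎ x ≺ y) →
                 toℕ (lab f x) < m
  card-downset {m} {x} ι covers = Finₚ.injective⇒≤ {f = g} g-injective
    where
      label : Fin (suc (toℕ (lab f x))) → Fin N
      label l = Fin.inject≤ l (Finₚ.toℕ<n (lab f x))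
      label-in-ι : ∀ l → ∃ λ a → ι a ≡ pos f (label l)
      label-in-ι l with covers (pos f (label l))
      ... | inj₁ in-ι = in-ι
      ... | inj₂ x≺y = ⊥-elim (<⇒≱ (mono x≺y) (begin
        toℕ (lab f (pos f (label l))) ≡⟨ cong toℕ (lab∘pos (label l)) ⟩
        toℕ (label l)                 ≡⟨ Finₚ.toℕ-inject≤ l _ ⟩
        toℕ l                         ≤⟨ ≤-pred (Finₚ.toℕ<n l) ⟩
        toℕ (lab f x)                 ∎))
        where open ≤-Reasoning
      g : Fin (suc (toℕ (lab f x))) → Fin m
      g l = proj₁ (label-in-ι l)
      g-injective : Injective _≡_ _≡_ g
      g-injective {k} {l} e = Finₚ.inject≤-injective _ _ k l (pos-injective (begin
        pos f (label k) ≡⟨ sym (proj₂ (label-in-ι k)) ⟩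
        ι (g k)         ≡⟨ cong ι e ⟩
        ι (g l)         ≡⟨ proj₂ (label-in-ι l) ⟩
        pos f (label l) ∎))
        where open ≡-Reasoning

reverse : ∀ {X N} → Labelling X N → Labelling X N
reverse f = mkLab (opposite ∘ lab f) (pos f ∘ opposite)

opposite-< : ∀ {N} {i j : Fin N} → i Fin.< j → opposite j Fin.< opposite i
opposite-< {N} {i} {j} i<j = subst₂ _<_ (sym (Finₚ.opposite-prop j)) (sym (Finₚ.opposite-prop i))
  (∸-monoʳ-< (s≤s i<j) (Finₚ.toℕ<n j))

reverse-isLinExt : ∀ {X N} {_≺_ : Rel X 0ℓ} {f : Labelling X N} →
                   IsLinExt _≺_ f → IsLinExt (flip _≺_) (reverse f)
reverse-isLinExt {f = f} ext = record
  { lab∘pos = λ i → trans (cong opposite (lab∘pos (opposite i))) (Finₚ.opposite-involutive i)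
  ; pos∘lab = λ x → trans (cong (pos f) (Finₚ.opposite-involutive (lab f x))) (pos∘lab x)
  ; mono    = opposite-< ∘ mono
  }
  where open IsLinExt ext

module LinearExtension {X : Set} {_≺_ : Rel X 0ℓ} {N : ℕ} {f : Labelling X N} (ext : IsLinExt _≺_ f) where
  open Counting ext public
  private module Reversed = Counting (reverse-isLinExt ext)

  card-above : ∀ {m x} (ι : Fin m → X) → Injective _≡_ _≡_ ι → (∀ a → x ≺ ι a) →
               m ≤ N ∸ suc (toℕ (lab f x))
  card-above {m} {x} ι ι-injective above =
    subst (m ≤_) (Finₚ.opposite-prop (lab f x)) (Reversed.card-below ι ι-injective above)

  card-upset : ∀ {m x} (ι : Fin m → X) → (∀ y → (∃ λ a → ι a ≡ y) ⊎ y ≺ x) →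
               N ∸ suc (toℕ (lab f x)) < m
  card-upset {m} {x} ι covers =
    subst (_< m) (Finₚ.opposite-prop (lab f x)) (Reversed.card-downset ι covers)

-- Position x ∈ {0, …, n - 1} of D_λ stands for the 0-based label p + x, and tᴰ i is the
-- permutation of positions by which t_i acts on the blocks: Block (t i f) c x ⇔ Block f c (tᴰ i x).
-- This action is contravariant, so downᴰ and qᴰ compose in the reverse order of down and q.
module Action (p n : ℕ) where

  tᴰ : ℕ → ℕ → ℕ
  tᴰ zero x = x
  tᴰ (suc i) x with p ≤? i | suc i ℕ.<? p + n
  ... | yes _ | yes _ = transposeℕ (i ∸ p) (suc (i ∸ p)) x
  ... | _     | _     = x

  downᴰ : ℕ → ℕ → ℕ
  downᴰ zero = id
  downᴰ (suc i) = downᴰ i ∘ tᴰ (suc i)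

  qᴰ : ℕ → ℕ → ℕ
  qᴰ zero = id
  qᴰ (suc i) = downᴰ (suc i) ∘ qᴰ i

  tᴰ-below : ∀ {i} x → ¬ p ≤ i → tᴰ (suc i) x ≡ x
  tᴰ-below {i} x p≰i with p ≤? i | suc i ℕ.<? p + n
  ... | yes p≤i | _ = ⊥-elim (p≰i p≤i)
  ... | no _    | _ = refl

  tᴰ-above : ∀ {i} x → ¬ suc i < p + n → tᴰ (suc i) x ≡ x
  tᴰ-above {i} x i≮ with p ≤? i | suc i ℕ.<? p + n
  ... | yes _ | yes i< = ⊥-elim (i≮ i<)
  ... | yes _ | no _   = refl
  ... | no _  | _      = refl

  tᴰ-inside : ∀ {i} x → p ≤ i → suc i < p + n → tᴰ (suc i) x ≡ transposeℕ (i ∸ p) (suc (i ∸ p)) x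
  tᴰ-inside {i} x p≤i i< with p ≤? i | suc i ℕ.<? p + n
  ... | yes _   | yes _  = refl
  ... | yes _   | no i≮ = ⊥-elim (i≮ i<)
  ... | no p≰i | _      = ⊥-elim (p≰i p≤i)

  transposeℕ≡⇔ : ∀ {i v x} → suc i ≢ p → suc i ≢ p + n → p ≤ v → v < p + n →
                 (transposeℕ i (suc i) v ≡ p + x) ⇔ (v ≡ p + tᴰ (suc i) x)
  transposeℕ≡⇔ {i} {v} {x} 1+i≢p 1+i≢p+n p≤v v<p+n with p ≤? i | suc i ℕ.<? p + n
  ... | yes p≤i | yes i<p+n = mk⇔
      (λ e → trans (sym p+y≡v) (cong (_+_ p) (trans (sym (transposeℕ-involutive e₀ (suc e₀) y))
               (cong (transposeℕ e₀ (suc e₀)) (+-cancelˡ-≡ p _ _ (trans (sym τv) e))))))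
      (λ e → trans τv (cong (_+_ p) (trans (cong (transposeℕ e₀ (suc e₀)) (+-cancelˡ-≡ p _ _ (trans p+y≡v e)))
               (transposeℕ-involutive e₀ (suc e₀) x))))
    where
      e₀ y : ℕ
      e₀ = i ∸ p
      y = v ∸ p
      p+y≡v : p + y ≡ v
      p+y≡v = m+[n∸m]≡n p≤v
      p+e₀≡i : p + e₀ ≡ i
      p+e₀≡i = m+[n∸m]≡n p≤i
      τv : transposeℕ i (suc i) v ≡ p + transposeℕ e₀ (suc e₀) y
      τv = begin
        transposeℕ i (suc i) v                       ≡⟨ cong₂ (λ a w → transposeℕ a (suc a) w) (sym p+e₀≡i) (sym p+y≡v) ⟩
        transposeℕ (p + e₀) (suc (p + e₀)) (p + y)   ≡⟨ cong (λ b → transposeℕ (p + e₀) b (p + y)) (sym (+-suc p e₀)) ⟩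
        transposeℕ (p + e₀) (p + suc e₀) (p + y)     ≡⟨ +-transposeℕ p e₀ (suc e₀) y ⟩
        p + transposeℕ e₀ (suc e₀) y                 ∎
        where open ≡-Reasoning
  ... | yes _ | no i≮p+n = subst (λ z → (z ≡ p + x) ⇔ (v ≡ p + x)) (sym (transposeℕ-other v≢i v≢1+i)) ⇔.refl
    where
      p+n<1+i : p + n < suc i
      p+n<1+i = ≤∧≢⇒< (≮⇒≥ i≮p+n) (1+i≢p+n ∘ sym)
      v≢i : v ≢ i
      v≢i refl = <⇒≱ v<p+n (≤-pred p+n<1+i)
      v≢1+i : v ≢ suc i
      v≢1+i refl = <⇒≱ v<p+n (<⇒≤ p+n<1+i)
  ... | no p≰i | _ = subst (λ z → (z ≡ p + x) ⇔ (v ≡ p + x)) (sym (transposeℕ-other v≢i v≢1+i)) ⇔.refl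
    where
      1+i<p : suc i < p
      1+i<p = ≤∧≢⇒< (≰⇒> p≰i) 1+i≢p
      v≢i : v ≢ i
      v≢i refl = <⇒≱ (<-trans (n<1+n v) 1+i<p) p≤v
      v≢1+i : v ≢ suc i
      v≢1+i refl = <⇒≱ 1+i<p p≤v

  private
    p+0≤p : p + 0 ≤ p
    p+0≤p = ≤-reflexive (+-identityʳ p)

  downᴰ-below : ∀ {i} → i ≤ p → ∀ x → downᴰ i x ≡ x
  downᴰ-below {zero} _ x = refl
  downᴰ-below {suc i} 1+i≤p x = trans (cong (downᴰ i) (tᴰ-below x (<⇒≱ 1+i≤p))) (downᴰ-below (<⇒≤ 1+i≤p) x)

  downᴰ-p+suc : ∀ {e} x → suc e < n → downᴰ (p + suc e) x ≡ downᴰ (p + e) (transposeℕ e (suc e) x)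
  downᴰ-p+suc {e} x 1+e<n rewrite +-suc p e =
    cong (downᴰ (p + e)) (trans (tᴰ-inside x (m≤m+n p e) (subst (_< p + n) (+-suc p e) (+-monoʳ-< p 1+e<n)))
                               (cong (λ z → transposeℕ z (suc z) x) (m+n∸m≡n p e)))

  downᴰ-cycle : ∀ {e} → e < n →
                (∀ x → x < e → downᴰ (p + e) x ≡ suc x) × downᴰ (p + e) e ≡ 0 × (∀ x → e < x → downᴰ (p + e) x ≡ x)
  downᴰ-cycle {zero} _ = (λ _ ()) , downᴰ-below p+0≤p 0 , (λ x _ → downᴰ-below p+0≤p x)
  downᴰ-cycle {suc e} 1+e<n with downᴰ-cycle (<-trans (n<1+n e) 1+e<n)
  ... | shifts , wraps , fixes = shifts′ , wraps′ , fixes′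
    where
      shifts′ : ∀ x → x < suc e → downᴰ (p + suc e) x ≡ suc x
      shifts′ x x<1+e with x ≟ e
      ... | yes refl = trans (downᴰ-p+suc x 1+e<n)
                             (trans (cong (downᴰ (p + x)) (transposeℕ-left x (suc x))) (fixes (suc x) (n<1+n x)))
      ... | no x≢e = trans (downᴰ-p+suc x 1+e<n)
                           (trans (cong (downᴰ (p + e)) (transposeℕ-other x≢e (<⇒≢ x<1+e)))
                                  (shifts x (≤∧≢⇒< (≤-pred x<1+e) x≢e)))
      wraps′ : downᴰ (p + suc e) (suc e) ≡ 0
      wraps′ = trans (downᴰ-p+suc (suc e) 1+e<n) (trans (cong (downᴰ (p + e)) (transposeℕ-right e (suc e))) wraps)
      fixes′ : ∀ x → suc e < x → downᴰ (p + suc e) x ≡ x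
      fixes′ x 1+e<x = trans (downᴰ-p+suc x 1+e<n)
        (trans (cong (downᴰ (p + e)) (transposeℕ-other (>⇒≢ e<x) (>⇒≢ 1+e<x))) (fixes x e<x))
        where
          e<x : e < x
          e<x = <-trans (n<1+n e) 1+e<x

  qᴰ-below : ∀ {i} → i ≤ p → ∀ x → qᴰ i x ≡ x
  qᴰ-below {zero} _ x = refl
  qᴰ-below {suc i} 1+i≤p x = trans (downᴰ-below 1+i≤p (qᴰ i x)) (qᴰ-below (<⇒≤ 1+i≤p) x)

  qᴰ-prefix : ∀ {e} → e < n → (∀ x → x ≤ e → qᴰ (p + e) x ≡ e ∸ x) × (∀ x → e < x → qᴰ (p + e) x ≡ x)
  qᴰ-prefix {zero} _ = (λ { .0 z≤n → qᴰ-below p+0≤p 0 }) , (λ x _ → qᴰ-below p+0≤p x)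
  qᴰ-prefix {suc e} 1+e<n with qᴰ-prefix (<-trans (n<1+n e) 1+e<n) | downᴰ-cycle 1+e<n
  ... | reflects , fixes | shifts , wraps , fixesᵈ = reflects′ , fixes′
    where
      qᴰ-p+suc : ∀ x → qᴰ (p + suc e) x ≡ downᴰ (p + suc e) (qᴰ (p + e) x)
      qᴰ-p+suc x rewrite +-suc p e = refl
      reflects′ : ∀ x → x ≤ suc e → qᴰ (p + suc e) x ≡ suc e ∸ x
      reflects′ x x≤1+e with x ≟ suc e
      ... | yes refl = trans (qᴰ-p+suc x)
                             (trans (cong (downᴰ (p + x)) (fixes x (n<1+n e))) (trans wraps (sym (n∸n≡0 x))))
      ... | no x≢1+e = trans (qᴰ-p+suc x)
                             (trans (cong (downᴰ (p + suc e)) (reflects x x≤e))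
                                    (trans (shifts (e ∸ x) (s≤s (m∸n≤m e x))) (sym (+-∸-assoc 1 x≤e))))
        where
          x≤e : x ≤ e
          x≤e = ≤-pred (≤∧≢⇒< x≤1+e x≢1+e)
      fixes′ : ∀ x → suc e < x → qᴰ (p + suc e) x ≡ x
      fixes′ x 1+e<x = trans (qᴰ-p+suc x)
        (trans (cong (downᴰ (p + suc e)) (fixes x (<-trans (n<1+n e) 1+e<x))) (fixesᵈ x 1+e<x))

module Rotation (p n₀ : ℕ) where
  n : ℕ
  n = suc n₀
  open Action p n

  downᴰ-beyond : ∀ u x → downᴰ (p + n₀ + u) x ≡ downᴰ (p + n₀) x
  downᴰ-beyond zero x = cong (λ i → downᴰ i x) (+-identityʳ (p + n₀))
  downᴰ-beyond (suc u) x rewrite +-suc (p + n₀) u =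
    trans (cong (downᴰ (p + n₀ + u)) (tᴰ-above x i≮p+n)) (downᴰ-beyond u x)
    where
      i≮p+n : ¬ suc (p + n₀ + u) < p + n
      i≮p+n i<p+n = <⇒≱ i<p+n (subst (_≤ suc (p + n₀ + u)) (sym (+-suc p n₀)) (s≤s (m≤m+n (p + n₀) u)))

  downᴰ-rotate : ∀ {y} → y < n → downᴰ (p + n₀) y ≡ suc y % n
  downᴰ-rotate {y} y<n with downᴰ-cycle (n<1+n n₀)
  ... | shifts , wraps , _ with y ≟ n₀
  ...   | yes refl = trans wraps (sym (n%n≡0 n))
  ...   | no y≢n₀ = trans (shifts y y<n₀) (sym (m<n⇒m%n≡m (s≤s y<n₀)))
    where
      y<n₀ : y < n₀
      y<n₀ = ≤∧≢⇒< (≤-pred y<n) y≢n₀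

  qᴰ-beyond : ∀ u {x} → x < n → qᴰ (p + n₀ + u) x ≡ (n₀ + u ∸ x) % n
  qᴰ-beyond zero {x} x<n rewrite +-identityʳ (p + n₀) | +-identityʳ n₀ =
    trans (proj₁ (qᴰ-prefix (n<1+n n₀)) x (≤-pred x<n)) (sym (m<n⇒m%n≡m (s≤s (m∸n≤m n₀ x))))
  qᴰ-beyond (suc u) {x} x<n = begin
    qᴰ (p + n₀ + suc u) x                     ≡⟨ cong (λ i → qᴰ i x) (+-suc (p + n₀) u) ⟩
    downᴰ (suc (p + n₀ + u)) (qᴰ (p + n₀ + u) x) ≡⟨ cong (λ i → downᴰ i (qᴰ (p + n₀ + u) x)) (sym (+-suc (p + n₀) u)) ⟩
    downᴰ (p + n₀ + suc u) (qᴰ (p + n₀ + u) x) ≡⟨ downᴰ-beyond (suc u) _ ⟩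
    downᴰ (p + n₀) (qᴰ (p + n₀ + u) x)       ≡⟨ cong (downᴰ (p + n₀)) (qᴰ-beyond u x<n) ⟩
    downᴰ (p + n₀) ((n₀ + u ∸ x) % n)        ≡⟨ downᴰ-rotate (m%n<n (n₀ + u ∸ x) n) ⟩
    suc ((n₀ + u ∸ x) % n) % n               ≡⟨ suc-% (n₀ + u ∸ x) ⟩
    suc (n₀ + u ∸ x) % n                     ≡⟨ cong (_% n) (sym (+-∸-assoc 1 (≤-trans (≤-pred x<n) (m≤m+n n₀ u)))) ⟩
    (suc (n₀ + u) ∸ x) % n                   ≡⟨ cong (λ z → (z ∸ x) % n) (sym (+-suc n₀ u)) ⟩
    (n₀ + suc u ∸ x) % n                     ∎
    where
      open ≡-Reasoning
      suc-% : ∀ a → suc (a % n) % n ≡ suc a % n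
      suc-% a = sym (trans (cong (λ z → suc z % n) (m≡m%n+[m/n]*n a n)) ([m+kn]%n≡m%n (suc (a % n)) (a / n) n))

module Moves (p q : ℕ) (P : FinPoset p) (Q : FinPoset q) {s : ℕ} (n : ℕ) (λs : Vec ℕ s) where
  N : ℕ
  N = p + n + q
  open Ordinal P λs Q
  open BenderKnuth _≺R_ _≺R?_ N renaming (q to q′)
  open Action p n

  Lab : Set
  Lab = Labelling (RCar p λs q) N

  record Layered (f : Lab) : Set where
    field
      lab∘pos  : ∀ l → lab f (pos f l) ≡ l
      pos∘lab  : ∀ x → pos f (lab f x) ≡ x
      labP<p   : ∀ a → toℕ (lab f (inj₁ a)) < p
      p≤labD   : ∀ d → p ≤ toℕ (lab f (inj₂ (inj₁ d)))
      labD<p+n : ∀ d → toℕ (lab f (inj₂ (inj₁ d))) < p + n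
      p+n≤labQ : ∀ b → p + n ≤ toℕ (lab f (inj₂ (inj₂ b)))

  linExt⇒layered : ∀ {f} → IsLinExt _≺R_ f → Layered f
  linExt⇒layered {f} ext = record
    { lab∘pos  = lab∘pos
    ; pos∘lab  = pos∘lab
    ; labP<p   = λ a → card-downset {x = inj₁ a} inj₁ λ { (inj₁ a′) → inj₁ (a′ , refl) ; (inj₂ _) → inj₂ tt }
    ; p≤labD   = λ d → card-below {x = inj₂ (inj₁ d)} inj₁ Sumₚ.inj₁-injective (λ _ → tt)
    ; labD<p+n = labD<p+n
    ; p+n≤labQ = p+n≤labQ
    }
    where
      open IsLinExt ext
      open LinearExtension ext
      inj₂∘inj₂ : Fin q → RCar p λs q
      inj₂∘inj₂ = inj₂ ∘ inj₂
      inj₂∘inj₂-injective : Injective _≡_ _≡_ inj₂∘inj₂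
      inj₂∘inj₂-injective = Sumₚ.inj₂-injective ∘ Sumₚ.inj₂-injective
      labD<p+n : ∀ d → toℕ (lab f (inj₂ (inj₁ d))) < p + n
      labD<p+n d = +-cancelʳ-≤ q _ _ (subst (_≤ N) (+-comm q _)
        (m≤o∸n⇒m+n≤o q (Finₚ.toℕ<n (lab f x)) (card-above {x = x} inj₂∘inj₂ inj₂∘inj₂-injective (λ _ → tt))))
        where
          x : RCar p λs q
          x = inj₂ (inj₁ d)
      p+n≤labQ : ∀ b → p + n ≤ toℕ (lab f (inj₂ (inj₂ b)))
      p+n≤labQ b = ≮⇒≥ λ l<p+n → <⇒≱ upset (begin
        q                ≡⟨ sym (m+n∸m≡n (p + n) q) ⟩
        N ∸ (p + n)      ≤⟨ ∸-monoʳ-≤ N l<p+n ⟩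
        N ∸ suc (toℕ (lab f x)) ∎)
        where
          open ≤-Reasoning
          x : RCar p λs q
          x = inj₂ (inj₂ b)
          upset : N ∸ suc (toℕ (lab f x)) < q
          upset = card-upset {x = x} inj₂∘inj₂ λ where
            (inj₁ _)         → inj₂ tt
            (inj₂ (inj₁ _))  → inj₂ tt
            (inj₂ (inj₂ b′)) → inj₁ (b′ , refl)

  Block : Lab → Fin s → ℕ → Set
  Block f c x = Σ[ a ∈ Fin (lookup λs c) ] toℕ (lab f (inj₂ (inj₁ (c , a)))) ≡ p + x

  module _ {f : Lab} (L : Layered f) where
    open Layered L

    toℕ-lab-pos : ∀ {l y} → pos f l ≡ y → toℕ (lab f y) ≡ toℕ l
    toℕ-lab-pos {l} refl = cong toℕ (lab∘pos l)

    pos-P : ∀ {l} → toℕ l < p → ∃ λ a → pos f l ≡ inj₁ a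
    pos-P {l} l<p with pos f l in e
    ... | inj₁ a         = a , refl
    ... | inj₂ (inj₁ d) = ⊥-elim (<⇒≱ l<p (subst (p ≤_) (toℕ-lab-pos e) (p≤labD d)))
    ... | inj₂ (inj₂ b) = ⊥-elim (<⇒≱ l<p (≤-trans (m≤m+n p n) (subst (p + n ≤_) (toℕ-lab-pos e) (p+n≤labQ b))))

    pos-D : ∀ {l} → p ≤ toℕ l → toℕ l < p + n → ∃ λ d → pos f l ≡ inj₂ (inj₁ d)
    pos-D {l} p≤l l<p+n with pos f l in e
    ... | inj₁ a         = ⊥-elim (<⇒≱ (subst (_< p) (toℕ-lab-pos e) (labP<p a)) p≤l)
    ... | inj₂ (inj₁ d) = d , refl
    ... | inj₂ (inj₂ b) = ⊥-elim (<⇒≱ l<p+n (subst (p + n ≤_) (toℕ-lab-pos e) (p+n≤labQ b)))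

    pos-Q : ∀ {l} → p + n ≤ toℕ l → ∃ λ b → pos f l ≡ inj₂ (inj₂ b)
    pos-Q {l} p+n≤l with pos f l in e
    ... | inj₁ a         = ⊥-elim (<⇒≱ (≤-trans (subst (_< p) (toℕ-lab-pos e) (labP<p a)) (m≤m+n p n)) p+n≤l)
    ... | inj₂ (inj₁ d) = ⊥-elim (<⇒≱ (subst (_< p + n) (toℕ-lab-pos e) (labD<p+n d)) p+n≤l)
    ... | inj₂ (inj₂ b) = b , refl

    P≺pos : ∀ {l} a → p ≤ toℕ l → inj₁ a ≺R pos f l
    P≺pos {l} a p≤l with pos f l in e
    ... | inj₁ a′ = ⊥-elim (<⇒≱ (subst (_< p) (toℕ-lab-pos e) (labP<p a′)) p≤l)
    ... | inj₂ _  = tt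

    pos≺Q : ∀ {l} b → toℕ l < p + n → pos f l ≺R inj₂ (inj₂ b)
    pos≺Q {l} b l<p+n with pos f l in e
    ... | inj₁ _         = tt
    ... | inj₂ (inj₁ _)  = tt
    ... | inj₂ (inj₂ b′) = ⊥-elim (<⇒≱ l<p+n (subst (p + n ≤_) (toℕ-lab-pos e) (p+n≤labQ b′)))

    comparable-at-boundary : ∀ {A B : Fin N} {i} → toℕ A ≡ i → toℕ B ≡ suc i →
                             suc i ≡ p ⊎ suc i ≡ p + n → Comparable (pos f A) (pos f B)
    comparable-at-boundary {A} {B} refl B≡1+A (inj₁ 1+A≡p) with pos-P {A} (≤-reflexive 1+A≡p)
    ... | a , posA = inj₁ (subst (_≺R pos f B) (sym posA) (P≺pos a (≤-reflexive (trans (sym 1+A≡p) (sym B≡1+A)))))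
    comparable-at-boundary {A} {B} refl B≡1+A (inj₂ 1+A≡p+n) with pos-Q {B} (≤-reflexive (trans (sym 1+A≡p+n) (sym B≡1+A)))
    ... | b , posB = inj₁ (subst (pos f A ≺R_) (sym posB) (pos≺Q b (≤-reflexive 1+A≡p+n)))

    -- Comparable elements of D_λ lie on a common chain.
    Block-transfer : ∀ {U V : Fin N} {c x y} → toℕ U ≡ p + x → toℕ V ≡ p + y → y < n →
                     Comparable (pos f U) (pos f V) → Block f c x → Block f c y
    Block-transfer {U} {V} {c} {x} {y} U≡p+x V≡p+y y<n U~V (a , lab≡p+x)
      with pos-D {V} (subst (p ≤_) (sym V≡p+y) (m≤m+n p y)) (subst (_< p + n) (sym V≡p+y) (+-monoʳ-< p y<n))
    ... | (c′ , a′) , posV with subst₂ Comparable posU posV U~V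
      where
        posU : pos f U ≡ inj₂ (inj₁ (c , a))
        posU = trans (cong (pos f) (sym (Finₚ.toℕ-injective (trans lab≡p+x (sym U≡p+x))))) (pos∘lab _)
    ... | inj₁ (refl , _) = a′ , trans (toℕ-lab-pos posV) V≡p+y
    ... | inj₂ (refl , _) = a′ , trans (toℕ-lab-pos posV) V≡p+y

  swapLabels : Lab → Fin N → Fin N → Lab
  swapLabels f a b = mkLab (swapFin a b ∘ lab f) (pos f ∘ swapFin a b)

  data Move (i : ℕ) (f : Lab) : Lab → Set where
    stay : (∀ (A B : Fin N) → toℕ A ≡ i → toℕ B ≡ suc i → Comparable (pos f A) (pos f B)) → Move i f f
    swap : (A B : Fin N) → toℕ A ≡ i → toℕ B ≡ suc i → ¬ Comparable (pos f A) (pos f B) →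
           Move i f (swapLabels f A B)

  move : ∀ i f → Move i f (t (suc i) f)
  move i f with suc i ℕ.<? N
  ... | no 1+i≮N = stay λ A B _ B≡1+i → ⊥-elim (1+i≮N (subst (_< N) B≡1+i (Finₚ.toℕ<n B)))
  ... | yes 1+i<N with (pos f A ≺R? pos f B) ⊎-dec (pos f B ≺R? pos f A)
    where
      A B : Fin N
      A = fromℕ< (<-trans (n<1+n i) 1+i<N)
      B = fromℕ< 1+i<N
  ...   | yes A~B = stay λ A′ B′ A′≡i B′≡1+i →
          subst₂ (λ A″ B″ → Comparable (pos f A″) (pos f B″))
            (Finₚ.toℕ-injective (trans (Finₚ.toℕ-fromℕ< _) (sym A′≡i)))
            (Finₚ.toℕ-injective (trans (Finₚ.toℕ-fromℕ< _) (sym B′≡1+i))) A~B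
  ...   | no A≁B = swap _ _ (Finₚ.toℕ-fromℕ< _) (Finₚ.toℕ-fromℕ< _) A≁B

  stay-blocks : ∀ {f} → Layered f → ∀ {i} →
                (∀ (A B : Fin N) → toℕ A ≡ i → toℕ B ≡ suc i → Comparable (pos f A) (pos f B)) →
                ∀ c x → Block f c x ⇔ Block f c (tᴰ (suc i) x)
  stay-blocks {f} L {i} A~B c x with p ≤? i | suc i ℕ.<? p + n
  ... | yes p≤i | yes 1+i<p+n =
        transposeℕ-resp-⇔ (Block f c) (mk⇔ (Block-transfer L A≡p+e B≡p+1+e 1+e<n A~B′)
                                         (Block-transfer L B≡p+1+e A≡p+e e<n (Sum.swap A~B′))) x
    where
      e : ℕ
      e = i ∸ p
      1+i<N : suc i < N
      1+i<N = ≤-trans 1+i<p+n (m≤m+n (p + n) q)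
      A B : Fin N
      A = fromℕ< (<-trans (n<1+n i) 1+i<N)
      B = fromℕ< 1+i<N
      A≡p+e : toℕ A ≡ p + e
      A≡p+e = trans (Finₚ.toℕ-fromℕ< _) (sym (m+[n∸m]≡n p≤i))
      p+1+e≡1+i : p + suc e ≡ suc i
      p+1+e≡1+i = trans (+-suc p e) (cong suc (m+[n∸m]≡n p≤i))
      B≡p+1+e : toℕ B ≡ p + suc e
      B≡p+1+e = trans (Finₚ.toℕ-fromℕ< _) (sym p+1+e≡1+i)
      1+e<n : suc e < n
      1+e<n = +-cancelˡ-< p _ _ (subst (_< p + n) (sym p+1+e≡1+i) 1+i<p+n)
      e<n : e < n
      e<n = <-trans (n<1+n e) 1+e<n
      A~B′ : Comparable (pos f A) (pos f B)
      A~B′ = A~B A B (Finₚ.toℕ-fromℕ< _) (Finₚ.toℕ-fromℕ< _)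
  ... | yes _ | no _ = ⇔.refl
  ... | no _  | _    = ⇔.refl

  module _ {f : Lab} (L : Layered f) {i : ℕ} {A B : Fin N} (A≡i : toℕ A ≡ i) (B≡1+i : toℕ B ≡ suc i)
           (A≁B : ¬ Comparable (pos f A) (pos f B)) where
    open Layered L

    private
      1+i≢p : suc i ≢ p
      1+i≢p 1+i≡p = A≁B (comparable-at-boundary L A≡i B≡1+i (inj₁ 1+i≡p))
      1+i≢p+n : suc i ≢ p + n
      1+i≢p+n 1+i≡p+n = A≁B (comparable-at-boundary L A≡i B≡1+i (inj₂ 1+i≡p+n))
      toℕ-swap : ∀ v → toℕ (swapFin A B v) ≡ transposeℕ i (suc i) (toℕ v)
      toℕ-swap v = trans (toℕ-swapFin A B v) (cong₂ (λ a b → transposeℕ a b (toℕ v)) A≡i B≡1+i)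

    swap-layered : Layered (swapLabels f A B)
    swap-layered = record
      { lab∘pos  = λ l → trans (cong (swapFin A B) (lab∘pos (swapFin A B l))) (swapFin-involutive A B l)
      ; pos∘lab  = λ x → trans (cong (pos f) (swapFin-involutive A B (lab f x))) (pos∘lab x)
      ; labP<p   = λ a → subst (_< p) (sym (toℕ-swap (lab f (inj₁ a)))) (transposeℕ-suc-< 1+i≢p (labP<p a))
      ; p≤labD   = λ d → subst (p ≤_) (sym (toℕ-swap (lab f (inj₂ (inj₁ d))))) (transposeℕ-suc-≥ 1+i≢p (p≤labD d))
      ; labD<p+n = λ d → subst (_< p + n) (sym (toℕ-swap (lab f (inj₂ (inj₁ d))))) (transposeℕ-suc-< 1+i≢p+n (labD<p+n d))
      ; p+n≤labQ = λ b → subst (p + n ≤_) (sym (toℕ-swap (lab f (inj₂ (inj₂ b))))) (transposeℕ-suc-≥ 1+i≢p+n (p+n≤labQ b))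
      }

    swap-blocks : ∀ c x → Block (swapLabels f A B) c x ⇔ Block f c (tᴰ (suc i) x)
    swap-blocks c x = mk⇔
      (λ (a , e) → a , Equivalence.to (moved a) (trans (sym (toℕ-swap (labD a))) e))
      (λ (a , e) → a , trans (toℕ-swap (labD a)) (Equivalence.from (moved a) e))
      where
        labD : Fin (lookup λs c) → Fin N
        labD a = lab f (inj₂ (inj₁ (c , a)))
        moved : ∀ a → (transposeℕ i (suc i) (toℕ (labD a)) ≡ p + x) ⇔ (toℕ (labD a) ≡ p + tᴰ (suc i) x)
        moved a = transposeℕ≡⇔ {x = x} 1+i≢p 1+i≢p+n (p≤labD (c , a)) (labD<p+n (c , a))

  Tracks : (Lab → Lab) → (ℕ → ℕ) → Set
  Tracks F π = ∀ f → Layered f → Layered (F f) × (∀ c x → Block (F f) c x ⇔ Block f c (π x))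

  tracks-id : Tracks id id
  tracks-id f L = L , λ _ _ → ⇔.refl

  tracks-∘ : ∀ {F G π ρ} → Tracks F π → Tracks G ρ → Tracks (G ∘ F) (π ∘ ρ)
  tracks-∘ {F} {ρ = ρ} F~π G~ρ f L with F~π f L
  ... | L′ , F-blocks with G~ρ (F f) L′
  ... | L″ , G-blocks = L″ , λ c x → ⇔.trans (G-blocks c x) (F-blocks c (ρ x))

  t-tracks : ∀ i → Tracks (t i) (tᴰ i)
  t-tracks zero = tracks-id
  t-tracks (suc i) f L with t (suc i) f | move i f
  ... | _ | stay A~B                = L , stay-blocks L A~B
  ... | _ | swap A B A≡i B≡1+i A≁B = swap-layered L A≡i B≡1+i A≁B , swap-blocks L A≡i B≡1+i A≁B

  down-tracks : ∀ i → Tracks (down i) (downᴰ i)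
  down-tracks zero = tracks-id
  down-tracks (suc i) = tracks-∘ (down-tracks i) (t-tracks (suc i))

  q-tracks : ∀ i → Tracks (q′ i) (qᴰ i)
  q-tracks zero = tracks-id
  q-tracks (suc i) = tracks-∘ (down-tracks (suc i)) (q-tracks i)

  qjk-tracks : ∀ j k → Tracks (qjk j k) (qᴰ (k ∸ 1) ∘ qᴰ (k ∸ j) ∘ qᴰ (k ∸ 1))
  qjk-tracks j k = tracks-∘ (q-tracks (k ∸ 1)) (tracks-∘ (q-tracks (k ∸ j)) (q-tracks (k ∸ 1)))

module Modular (n : ℕ) .{{_ : NonZero n}} where

  %-unique : ∀ {ρ v} (W : ℤ) → ρ < n → + v ≡ + ρ ℤ.+ W ℤ.* + n → v % n ≡ ρ
  %-unique {ρ} {v} (+ w) ρ<n v≡ρ+Wn = begin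
    v % n            ≡⟨ cong (_% n) (ℤₚ.+-injective v≡ρ+w*n) ⟩
    (ρ + w * n) % n  ≡⟨ [m+kn]%n≡m%n ρ w n ⟩
    ρ % n            ≡⟨ m<n⇒m%n≡m ρ<n ⟩
    ρ                ∎
    where
      open ≡-Reasoning
      v≡ρ+w*n : + v ≡ + (ρ + w * n)
      v≡ρ+w*n = trans v≡ρ+Wn (trans (cong (ℤ._+_ (+ ρ)) (sym (ℤₚ.pos-* w n))) (sym (ℤₚ.pos-+ ρ (w * n))))
  %-unique {ρ} {v} -[1+ w ] ρ<n v≡ρ-[1+w]n = ⊥-elim (<⇒≱ ρ<n (begin
    n               ≤⟨ m≤m+n n (w * n) ⟩
    suc w * n       ≤⟨ m≤n+m (suc w * n) v ⟩
    v + suc w * n   ≡⟨ ℤₚ.+-injective v+[1+w]n≡ρ ⟩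
    ρ               ∎))
    where
      open ≤-Reasoning
      cancel : ∀ (r z m : ℤ) → r ℤ.+ (ℤ.- z) ℤ.* m ℤ.+ z ℤ.* m ≡ r
      cancel = solve-∀
      v+[1+w]n≡ρ : + (v + suc w * n) ≡ + ρ
      v+[1+w]n≡ρ = trans (ℤₚ.pos-+ v (suc w * n))
        (trans (cong₂ ℤ._+_ v≡ρ-[1+w]n (ℤₚ.pos-* (suc w) n)) (cancel (+ ρ) (+ suc w) (+ n)))

  %ℕ-via-ℕ : ∀ a k v → a ℤ.+ + (k * n) ≡ + v → a %ℕ n ≡ v % n
  %ℕ-via-ℕ a k v a+kn≡v = sym (%-unique (a /ℕ n ℤ.+ + k) (n%ℕd<d a n) (begin
    + v                                              ≡⟨ sym a+kn≡v ⟩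
    a ℤ.+ + (k * n)                                  ≡⟨ cong₂ ℤ._+_ (a≡a%ℕn+[a/ℕn]*n a n) (ℤₚ.pos-* k n) ⟩
    + (a %ℕ n) ℤ.+ a /ℕ n ℤ.* + n ℤ.+ + k ℤ.* + n    ≡⟨ distrib (+ (a %ℕ n)) (a /ℕ n) (+ k) (+ n) ⟩
    + (a %ℕ n) ℤ.+ (a /ℕ n ℤ.+ + k) ℤ.* + n          ∎))
    where
      open ≡-Reasoning
      distrib : ∀ (r z k m : ℤ) → r ℤ.+ z ℤ.* m ℤ.+ k ℤ.* m ≡ r ℤ.+ (z ℤ.+ k) ℤ.* m
      distrib = solve-∀

  mod1-via-ℕ : ∀ a k v → a ℤ.+ + (k * n) ≡ + suc v → a mod1 n ≡ suc (v % n)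
  mod1-via-ℕ a k v a+kn≡1+v = cong suc (%ℕ-via-ℕ (a ℤ.- + 1) k v (begin
    a ℤ.- + 1 ℤ.+ + (k * n)   ≡⟨ swap-1 a (+ (k * n)) ⟩
    a ℤ.+ + (k * n) ℤ.- + 1   ≡⟨ cong (ℤ._- + 1) a+kn≡1+v ⟩
    + suc v ℤ.- + 1           ≡⟨ ℤₚ.m-n≡m⊖n (suc v) 1 ⟩
    + v                       ∎))
    where
      open ≡-Reasoning
      swap-1 : ∀ (a b : ℤ) → a ℤ.- + 1 ℤ.+ b ≡ a ℤ.+ b ℤ.- + 1
      swap-1 = solve-∀

  reflect-involutive : ∀ {K x} → n ≤ suc K → x < n → (K ∸ (K ∸ x) % n) % n ≡ x
  reflect-involutive {K} {x} n≤1+K x<n = begin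
    (K ∸ (K ∸ x) % n) % n                     ≡⟨ cong (λ z → (z ∸ (K ∸ x) % n) % n) K≡ ⟩
    ((x + (K ∸ x) / n * n) + (K ∸ x) % n ∸ (K ∸ x) % n) % n ≡⟨ cong (_% n) (m+n∸n≡m _ ((K ∸ x) % n)) ⟩
    (x + (K ∸ x) / n * n) % n                 ≡⟨ [m+kn]%n≡m%n x ((K ∸ x) / n) n ⟩
    x % n                                     ≡⟨ m<n⇒m%n≡m x<n ⟩
    x                                         ∎
    where
      open ≡-Reasoning
      K≡ : K ≡ (x + (K ∸ x) / n * n) + (K ∸ x) % n
      K≡ = begin
        K                                       ≡⟨ sym (m+[n∸m]≡n (≤-pred (≤-trans x<n n≤1+K))) ⟩
        x + (K ∸ x)                             ≡⟨ cong (_+_ x) (trans (m≡m%n+[m/n]*n (K ∸ x) n) (+-comm ((K ∸ x) % n) _)) ⟩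
        x + ((K ∸ x) / n * n + (K ∸ x) % n)     ≡⟨ sym (+-assoc x _ _) ⟩
        x + (K ∸ x) / n * n + (K ∸ x) % n       ∎

module Conjugation (p n₀ r ℓ : ℕ) (ℓ<n : ℓ < suc n₀) where
  n K : ℕ
  n = suc n₀
  K = n₀ + r
  open Action p n
  open Modular n

  ρ : ℕ → ℕ
  ρ x = (K ∸ x) % n

  τ : ℕ → ℕ
  τ = qᴰ (p + ℓ)

  Π : ℕ → ℕ
  Π = ρ ∘ τ ∘ ρ

  ℓ≤K : ℓ ≤ K
  ℓ≤K = ≤-trans (≤-pred ℓ<n) (m≤m+n n₀ r)

  ρ<n : ∀ x → ρ x < n
  ρ<n x = m%n<n (K ∸ x) n

  ρ-involutive : ∀ {x} → x < n → ρ (ρ x) ≡ x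
  ρ-involutive = reflect-involutive (s≤s (m≤m+n n₀ r))

  τ-reverse : ∀ {x} → x ≤ ℓ → τ x ≡ ℓ ∸ x
  τ-reverse = proj₁ (qᴰ-prefix ℓ<n) _

  τ-fix : ∀ {x} → ℓ < x → τ x ≡ x
  τ-fix = proj₂ (qᴰ-prefix ℓ<n) _

  τ<n : ∀ {x} → x < n → τ x < n
  τ<n {x} x<n with x ≤? ℓ
  ... | yes x≤ℓ = subst (_< n) (sym (τ-reverse x≤ℓ)) (≤-<-trans (m∸n≤m ℓ x) ℓ<n)
  ... | no x≰ℓ = subst (_< n) (sym (τ-fix (≰⇒> x≰ℓ))) x<n

  τ-involutive : ∀ x → τ (τ x) ≡ x
  τ-involutive x with x ≤? ℓ
  ... | yes x≤ℓ = trans (cong τ (τ-reverse x≤ℓ)) (trans (τ-reverse (m∸n≤m ℓ x)) (m∸[m∸n]≡n x≤ℓ))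
  ... | no x≰ℓ = trans (cong τ (τ-fix (≰⇒> x≰ℓ))) (τ-fix (≰⇒> x≰ℓ))

  Π-involutive : ∀ {x} → x < n → Π (Π x) ≡ x
  Π-involutive {x} x<n = begin
    ρ (τ (ρ (ρ (τ (ρ x))))) ≡⟨ cong (ρ ∘ τ) (ρ-involutive (τ<n (ρ<n x))) ⟩
    ρ (τ (τ (ρ x)))         ≡⟨ cong ρ (τ-involutive (ρ x)) ⟩
    ρ (ρ x)                 ≡⟨ ρ-involutive x<n ⟩
    x                       ∎
    where open ≡-Reasoning

  qjkᴰ≡Π : ∀ {j k x} → k ∸ 1 ≡ p + n₀ + r → k ∸ j ≡ p + ℓ → x < n →
           qᴰ (k ∸ 1) (qᴰ (k ∸ j) (qᴰ (k ∸ 1) x)) ≡ Π x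
  qjkᴰ≡Π {x = x} k-1≡ k-j≡ x<n rewrite k-1≡ | k-j≡ | Rotation.qᴰ-beyond p n₀ r x<n =
    Rotation.qᴰ-beyond p n₀ r (τ<n (ρ<n x))

  m : ℕ
  m = (+ r) mod1 n

  m≡1+K%n : m ≡ suc (K % n)
  m≡1+K%n = mod1-via-ℕ (+ r) 1 K (trans (sym (ℤₚ.pos-+ r (1 * n)))
    (cong +_ (trans (cong (_+_ r) (*-identityˡ n)) (trans (+-suc r n₀) (cong suc (+-comm r n₀))))))

  mod1-shift : ∀ {t} → t ≤ K → (+ m ℤ.- + t) mod1 n ≡ suc (ρ t)
  mod1-shift {t} t≤K = mod1-via-ℕ (+ m ℤ.- + t) (K / n) (K ∸ t) (begin
    + m ℤ.- + t ℤ.+ + (K / n * n)                ≡⟨ cong (λ z → + z ℤ.- + t ℤ.+ + (K / n * n)) m≡1+K%n ⟩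
    + suc (K % n) ℤ.- + t ℤ.+ + (K / n * n)      ≡⟨ reorder (+ suc (K % n)) (+ t) (+ (K / n * n)) ⟩
    + suc (K % n) ℤ.+ + (K / n * n) ℤ.- + t      ≡⟨ cong (ℤ._- + t) (sym (ℤₚ.pos-+ (suc (K % n)) (K / n * n))) ⟩
    + suc (K % n + K / n * n) ℤ.- + t            ≡⟨ cong (λ z → + suc z ℤ.- + t) (sym (m≡m%n+[m/n]*n K n)) ⟩
    + suc K ℤ.- + t                              ≡⟨ ℤₚ.m-n≡m⊖n (suc K) t ⟩
    suc K ℤ.⊖ t                                  ≡⟨ ℤₚ.⊖-≥ (≤-trans t≤K (n≤1+n K)) ⟩
    + (suc K ∸ t)                                ≡⟨ cong +_ (+-∸-assoc 1 t≤K) ⟩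
    + suc (K ∸ t)                                ∎)
    where
      open ≡-Reasoning
      reorder : ∀ (a b c : ℤ) → a ℤ.- b ℤ.+ c ≡ a ℤ.+ c ℤ.- b
      reorder = solve-∀

  mod1-window : ∀ {t} → t ≤ ℓ → ((+ m ℤ.- + ℓ) ℤ.+ + t) mod1 n ≡ suc (ρ (ℓ ∸ t))
  mod1-window {t} t≤ℓ = trans (cong (_mod1 n) (begin
    (+ m ℤ.- + ℓ) ℤ.+ + t                  ≡⟨ cong (λ z → (+ m ℤ.- z) ℤ.+ + t) ℓ≡ ⟩
    (+ m ℤ.- (+ (ℓ ∸ t) ℤ.+ + t)) ℤ.+ + t  ≡⟨ cancel (+ m) (+ (ℓ ∸ t)) (+ t) ⟩
    + m ℤ.- + (ℓ ∸ t)                      ∎)) (mod1-shift (≤-trans (m∸n≤m ℓ t) ℓ≤K))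
    where
      open ≡-Reasoning
      ℓ≡ : + ℓ ≡ + (ℓ ∸ t) ℤ.+ + t
      ℓ≡ = trans (cong +_ (sym (m∸n+n≡m t≤ℓ))) (ℤₚ.pos-+ (ℓ ∸ t) t)
      cancel : ∀ (a b c : ℤ) → (a ℤ.- (b ℤ.+ c)) ℤ.+ c ≡ a ℤ.- b
      cancel = solve-∀

  -- In 0-based positions the hypotheses on w say that it sends ρ (ℓ ∸ t) to ρ t and fixes the rest.
  w≗Π : (w : Fin n → Fin n) →
        (∀ t → t ≤ ℓ → ∀ c → suc (toℕ c) ≡ ((+ m ℤ.- + ℓ) ℤ.+ + t) mod1 n →
           suc (toℕ (w c)) ≡ (+ m ℤ.- + t) mod1 n) →
        (∀ c → (∀ t → t ≤ ℓ → suc (toℕ c) ≢ ((+ m ℤ.- + ℓ) ℤ.+ + t) mod1 n) → w c ≡ c) →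
        ∀ c → toℕ (w c) ≡ Π (toℕ c)
  w≗Π w moved fixed c with ρ (toℕ c) ≤? ℓ
  ... | yes y≤ℓ = suc-injective (begin
    suc (toℕ (w c))       ≡⟨ moved (ℓ ∸ y) (m∸n≤m ℓ y) c c-in-window ⟩
    (+ m ℤ.- + (ℓ ∸ y)) mod1 n ≡⟨ mod1-shift (≤-trans (m∸n≤m ℓ y) ℓ≤K) ⟩
    suc (ρ (ℓ ∸ y))       ≡⟨ cong (suc ∘ ρ) (sym (τ-reverse y≤ℓ)) ⟩
    suc (Π (toℕ c))       ∎)
    where
      open ≡-Reasoning
      y : ℕ
      y = ρ (toℕ c)
      c-in-window : suc (toℕ c) ≡ ((+ m ℤ.- + ℓ) ℤ.+ + (ℓ ∸ y)) mod1 n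
      c-in-window = sym (trans (mod1-window (m∸n≤m ℓ y))
        (cong suc (trans (cong ρ (m∸[m∸n]≡n y≤ℓ)) (ρ-involutive (Finₚ.toℕ<n c)))))
  ... | no y≰ℓ = begin
    toℕ (w c)             ≡⟨ cong toℕ (fixed c outside-window) ⟩
    toℕ c                 ≡⟨ sym (ρ-involutive (Finₚ.toℕ<n c)) ⟩
    ρ (ρ (toℕ c))         ≡⟨ cong ρ (sym (τ-fix (≰⇒> y≰ℓ))) ⟩
    Π (toℕ c)             ∎
    where
      open ≡-Reasoning
      outside-window : ∀ t → t ≤ ℓ → suc (toℕ c) ≢ ((+ m ℤ.- + ℓ) ℤ.+ + t) mod1 n
      outside-window t t≤ℓ c≡ = y≰ℓ (subst (_≤ ℓ) (sym y≡ℓ-t) (m∸n≤m ℓ t))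
        where
          y≡ℓ-t : ρ (toℕ c) ≡ ℓ ∸ t
          y≡ℓ-t = trans (cong ρ (suc-injective (trans c≡ (mod1-window t≤ℓ))))
                        (ρ-involutive (≤-<-trans (m∸n≤m ℓ t) ℓ<n))

  image-of-Π : (w : Fin n → Fin n) → (∀ c → toℕ (w c) ≡ Π (toℕ c)) →
               (B : ℕ → Set) → (B ∘ Π ∘ toℕ) ≐ image w (B ∘ toℕ)
  image-of-Π w w≗ B = preimage , λ { (c , Bc , refl) → subst B (c≡Π[wc] c) Bc }
    where
      c≡Π[wc] : ∀ c → toℕ c ≡ Π (toℕ (w c))
      c≡Π[wc] c = trans (sym (Π-involutive (Finₚ.toℕ<n c))) (cong Π (sym (w≗ c)))
      preimage : ∀ {b} → B (Π (toℕ b)) → image w (B ∘ toℕ) b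
      preimage {b} BΠb = c , subst B (sym toℕ-c) BΠb ,
        Finₚ.toℕ-injective (trans (w≗ c) (trans (cong Π toℕ-c) (Π-involutive (Finₚ.toℕ<n b))))
        where
          c : Fin n
          c = fromℕ< (ρ<n (τ (ρ (toℕ b))))
          toℕ-c : toℕ c ≡ Π (toℕ b)
          toℕ-c = Finₚ.toℕ-fromℕ< (ρ<n (τ (ρ (toℕ b))))

corollary4p7 :
    (p q : ℕ) (P : FinPoset p) (Q : FinPoset q)
    (s n : ℕ) (λs : Vec ℕ s) → IsPartition λs n → 1 < s → .{{_ : NonZero n}} →
    (j k r : ℕ) → 1 ≤ j → j < k → k ≤ p + n + q → k ≡ p + n + r →
    p < k ∸ j → k ∸ j < p + n →
    let m = (+ r) mod1 n
        ℓ = k ∸ j ∸ p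
        _≺R_ = Ordinal._≺R_ P λs Q
        qjk = BenderKnuth.qjk _≺R_ (Ordinal._≺R?_ P λs Q) (p + n + q)
    in (w : Fin n → Fin n) →
       (∀ t → t ≤ ℓ → ∀ c → suc (toℕ c) ≡ ((+ m ℤ.- + ℓ) ℤ.+ + t) mod1 n →
          suc (toℕ (w c)) ≡ (+ m ℤ.- + t) mod1 n) →
       (∀ c → (∀ t → t ≤ ℓ → suc (toℕ c) ≢ ((+ m ℤ.- + ℓ) ℤ.+ + t) mod1 n) → w c ≡ c) →
       (f : Labelling (RCar p λs q) (p + n + q)) → IsLinExt _≺R_ f →
       ∀ i → OSP {p} {q} {s} {n} λs (qjk j k f) i ≐ image w (OSP {p} {q} {s} {n} λs f i)
corollary4p7 p q P Q s zero λs _ _ {{()}}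
corollary4p7 p q P Q s (suc n₀) λs _ _ j k r _ _ _ refl p<k∸j k∸j<p+n w moved fixed f ext i =
    (λ in-qjk → proj₁ Π-image (Equivalence.to (blocks (Finₚ.toℕ<n _)) in-qjk))
  , (λ in-image → Equivalence.from (blocks (Finₚ.toℕ<n _)) (proj₂ Π-image in-image))
  where
    ℓ : ℕ
    ℓ = k ∸ j ∸ p
    ℓ<n : ℓ < suc n₀
    ℓ<n = subst (ℓ <_) (m+n∸m≡n p (suc n₀)) (∸-monoˡ-< k∸j<p+n (<⇒≤ p<k∸j))
    open Moves p q P Q (suc n₀) λs
    open Conjugation p n₀ r ℓ ℓ<n
    open BenderKnuth (Ordinal._≺R_ P λs Q) (Ordinal._≺R?_ P λs Q) N using (qjk)
    blocks : ∀ {x} → x < n → Block (qjk j k f) i x ⇔ Block f i (Π x)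
    blocks {x} x<n = subst (λ y → Block (qjk j k f) i x ⇔ Block f i y)
      (qjkᴰ≡Π {j} {k} (cong (λ z → z + r ∸ 1) (+-suc p n₀)) (sym (m+[n∸m]≡n (<⇒≤ p<k∸j))) x<n)
      (proj₂ (qjk-tracks j k f (linExt⇒layered ext)) i x)
    Π-image : (Block f i ∘ Π ∘ toℕ) ≐ image w (Block f i ∘ toℕ)
    Π-image = image-of-Π w (w≗Π w moved fixed) (Block f i)
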